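{- For $n\ge1$ let $k_n=\lfloor\log_2 n\rfloor$ and let $$\mathcal{F}_n=\Big\{(\epsilon_1,\dots,\epsilon_n)\in\{0,2\}^n : \mathcal{C}_{k_n}(\epsilon_1,\dots,\epsilon_n)\ge \tfrac14 n\Big\}.$$ Then $\#\mathcal{F}_n\ge \tfrac1{16}\cdot 2^n$.
   Context: For a finite word $(\epsilon_1,\dots,\epsilon_n)$ and $t\ge0$, $\mathcal{C}_t(\epsilon_1,\dots,\epsilon_n)$ denotes the number of distinct words of length $t$ that occur as contiguous subwords $(\epsilon_{i+1},\dots,\epsilon_{i+t})$, $0\le i\le n-t$, of $(\epsilon_1,\dots,\epsilon_n)$. -}

module Defs where

open import Data.Nat using (ℕ; zero; suc; _+_; _*_; _∸_; _^_; _≤_; _≤?_)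
open import Data.Nat.Logarithm using (⌊log₂_⌋)
open import Data.List using (List; []; _∷_; length; map; take; drop; upTo; filter; deduplicate; applyUpTo)
open import Data.List.Properties using (≡-dec)
open import Relation.Nullary using (Dec; yes; no)
open import Relation.Nullary.Decidable using (⌊_⌋)
open import Relation.Binary.PropositionalEquality using (_≡_; refl)

data Digit : Set where
  d0 d2 : Digit

_≟D_ : (a b : Digit) → Dec (a ≡ b)
d0 ≟D d0 = yes refl
d0 ≟D d2 = no λ ()
d2 ≟D d0 = no λ ()
d2 ≟D d2 = yes refl

Word : Set
Word = List Digit

offsets : ℕ → ℕ → List ℕ
offsets n t with t ≤? n
... | yes _ = upTo (suc (n ∸ t))
... | no  _ = []

factorAt : ℕ → Word → ℕ → Word
factorAt t w i = take t (drop i w)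

complexity : ℕ → Word → ℕ
complexity t w =
  length (deduplicate (≡-dec _≟D_) (map (factorAt t w) (offsets (length w) t)))

allWords : ℕ → List Word
allWords zero    = [] ∷ []
allWords (suc n) = map (d0 ∷_) (allWords n) Data.List.++ map (d2 ∷_) (allWords n)

k : ℕ → ℕ
k n = ⌊log₂ n ⌋

-- membership test for 𝓕ₙ :  𝒞_{kₙ}(w) ≥ n/4  ⇔  n ≤ 4·𝒞_{kₙ}(w)
inF? : (n : ℕ) → (w : Word) → Dec (n ≤ 4 * complexity (k n) w)
inF? n w = n ≤? 4 * complexity (k n) w

-- 𝓕ₙ as a list of (distinct) words of length n
𝓕 : ℕ → List Word
𝓕 n = filter (inF? n) (allWords n)

-- Average over all 2^n words.  Write K = ⌊log₂ n⌋ and L = n − K + 1 for the number of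
-- windows of length K in a word w.  A value occurring c ≥ 1 times among the windows
-- contributes 2c to 2L and 3 + (c choose 2) to 3·𝒞_K(w) + #(pairs of equal windows), so
-- 2L ≤ 3·𝒞_K(w) + #(equal pairs).  Two fixed windows agree on at most 2^(n−K) words, so
-- the average number of equal pairs is at most (L choose 2)/2^K; hence the average
-- complexity is large.  On the other hand 𝒞_K(w) ≤ L always and 𝒞_K(w) < n/4 off 𝓕_n,
-- which bounds the average from above in terms of #𝓕_n.  The two bounds combine to
-- 2^n ≤ 16·#𝓕_n as soon as 12·2^K·n + 16·(L choose 2) ≤ 29·2^K·L, an inequality that is
-- checked by evaluation for n < 128 and follows from 13K ≤ 2^K for larger n.
module Submission where

open import Defs
open import Data.Bool using (true; false)
open import Data.Empty using (⊥-elim)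
open import Data.List using (List; []; _∷_; _++_; length; map; filter; take; drop; applyUpTo; upTo; deduplicate)
open import Data.List.Properties
  using (≡-dec; filter-idem; length-filter; length-++; length-map; drop-drop; map-applyUpTo; length-applyUpTo; length-deduplicate)
open import Data.List.Relation.Unary.All using (All; []; _∷_; universal) renaming (map to All-map)
import Data.List.Relation.Unary.All.Properties as All
open import Data.Nat using (ℕ; zero; suc; _+_; _*_; _^_; _∸_; _≤_; _<_; z≤n; s≤s; s≤s⁻¹; z<s; s<s; _≤?_; _<?_;
  ⌊_/2⌋; ⌈_/2⌉; NonZero; _≤′_; ≤′-refl; ≤′-step)
open import Data.Nat.Properties
open import Data.Nat.Combinatorics using (_C_; nC1≡n; nCk+nC[k+1]≡[n+1]C[k+1])
open import Data.Nat.Induction using (<-wellFounded)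
open import Data.Nat.Logarithm using (⌊log₂_⌋; ⌊log₂⌋-mono-≤; ⌊log₂[2^n]⌋≡n)
open import Data.Nat.Logarithm.Core using (⌊log2⌋)
open import Data.Nat.Tactic.RingSolver using (solve-∀)
open import Data.Unit using (tt)
open import Function using (_∘_; id)
open import Induction.WellFounded using (Acc; acc)
open import Relation.Binary.Definitions using (DecidableEquality)
open import Relation.Binary.PropositionalEquality
open import Relation.Nullary using (Dec; yes; no; does; ¬?; contradiction)
open import Relation.Nullary.Decidable using (toWitness)
open import Relation.Unary using (Pred; Decidable)

indicator : ∀ {p} {P : Set p} → Dec P → ℕ
indicator (yes _) = 1
indicator (no  _) = 0

[1+n]C2≡n+nC2 : ∀ n → suc n C 2 ≡ n + n C 2
[1+n]C2≡n+nC2 n = begin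
  suc n C 2       ≡⟨ nCk+nC[k+1]≡[n+1]C[k+1] n 1 ⟨
  n C 1 + n C 2   ≡⟨ cong (_+ n C 2) (nC1≡n n) ⟩
  n + n C 2       ∎
  where open ≡-Reasoning

n≤1+nC2 : ∀ n → n ≤ 1 + n C 2
n≤1+nC2 zero    = z≤n
n≤1+nC2 (suc n) = s≤s (subst (n ≤_) (sym ([1+n]C2≡n+nC2 n)) (m≤m+n n (n C 2)))

2*[1+n]≤3+[1+n]C2 : ∀ n → 2 * suc n ≤ 3 + suc n C 2
2*[1+n]≤3+[1+n]C2 n = begin
  2 * suc n             ≡⟨ double n ⟩
  2 + n + n             ≤⟨ +-monoʳ-≤ (2 + n) (n≤1+nC2 n) ⟩
  2 + n + (1 + n C 2)   ≡⟨ regroup n (n C 2) ⟩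
  3 + (n + n C 2)       ≡⟨ cong (3 +_) ([1+n]C2≡n+nC2 n) ⟨
  3 + suc n C 2         ∎
  where
  open ≤-Reasoning
  double : ∀ n → 2 * suc n ≡ 2 + n + n
  double = solve-∀
  regroup : ∀ n c → 2 + n + (1 + c) ≡ 3 + (n + c)
  regroup = solve-∀

2*nC2≤n*n : ∀ n → 2 * (n C 2) ≤ n * n
2*nC2≤n*n zero    = z≤n
2*nC2≤n*n (suc n) = begin
  2 * (suc n C 2)       ≡⟨ cong (2 *_) ([1+n]C2≡n+nC2 n) ⟩
  2 * (n + n C 2)       ≡⟨ *-distribˡ-+ 2 n (n C 2) ⟩
  2 * n + 2 * (n C 2)   ≤⟨ +-monoʳ-≤ (2 * n) (2*nC2≤n*n n) ⟩
  2 * n + n * n         ≤⟨ n≤1+n (2 * n + n * n) ⟩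
  suc (2 * n + n * n)   ≡⟨ square n ⟨
  suc n * suc n         ∎
  where
  open ≤-Reasoning
  square : ∀ n → suc n * suc n ≡ suc (2 * n + n * n)
  square = solve-∀

filter-comm : ∀ {a p q} {A : Set a} {P : Pred A p} {Q : Pred A q} (P? : Decidable P) (Q? : Decidable Q)
              (xs : List A) → filter P? (filter Q? xs) ≡ filter Q? (filter P? xs)
filter-comm P? Q? []       = refl
filter-comm P? Q? (x ∷ xs) with does (Q? x) in eQ | does (P? x) in eP
... | true  | true  rewrite eP | eQ = cong (x ∷_) (filter-comm P? Q? xs)
... | true  | false rewrite eP      = filter-comm P? Q? xs
... | false | true  rewrite eQ      = filter-comm P? Q? xs
... | false | false                 = filter-comm P? Q? xs

module EqualPairs {a} {A : Set a} (_≟_ : DecidableEquality A) where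

  count : A → List A → ℕ
  count x []       = 0
  count x (y ∷ ys) = indicator (x ≟ y) + count x ys

  equalPairs : List A → ℕ
  equalPairs []       = 0
  equalPairs (y ∷ ys) = count y ys + equalPairs ys

  remove : A → List A → List A
  remove x = filter (¬? ∘ (x ≟_))

  dedup : List A → List A
  dedup = deduplicate _≟_

  length-remove : ∀ x xs → length xs ≡ count x xs + length (remove x xs)
  length-remove x []       = refl
  length-remove x (y ∷ ys) with x ≟ y
  ... | yes _ = cong suc (length-remove x ys)
  ... | no  _ = trans (cong suc (length-remove x ys)) (sym (+-suc _ _))

  count-remove : ∀ {x y} → y ≢ x → ∀ ys → count y (remove x ys) ≡ count y ys
  count-remove y≢x []       = refl
  count-remove {x} {y} y≢x (z ∷ zs) with x ≟ z
  ... | yes refl with y ≟ x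
  ...   | yes y≡x = ⊥-elim (y≢x y≡x)
  ...   | no  _   = count-remove y≢x zs
  count-remove {x} {y} y≢x (z ∷ zs) | no _ = cong (indicator (y ≟ z) +_) (count-remove y≢x zs)

  equalPairs-remove : ∀ x xs → equalPairs xs ≡ equalPairs (remove x xs) + count x xs C 2
  equalPairs-remove x []       = refl
  equalPairs-remove x (y ∷ ys) with x ≟ y
  ... | yes refl = begin
    c + equalPairs ys                        ≡⟨ cong (c +_) (equalPairs-remove x ys) ⟩
    c + (equalPairs (remove x ys) + c C 2)   ≡⟨ x+[y+z]≡y+[x+z] c (equalPairs (remove x ys)) (c C 2) ⟩
    equalPairs (remove x ys) + (c + c C 2)   ≡⟨ cong (equalPairs (remove x ys) +_) ([1+n]C2≡n+nC2 c) ⟨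
    equalPairs (remove x ys) + suc c C 2     ∎
    where
    open ≡-Reasoning
    c = count x ys
    x+[y+z]≡y+[x+z] : ∀ x y z → x + (y + z) ≡ y + (x + z)
    x+[y+z]≡y+[x+z] = solve-∀
  ... | no  x≢y  = trans (cong₂ _+_ (sym (count-remove (x≢y ∘ sym) ys)) (equalPairs-remove x ys))
                         (sym (+-assoc (count y (remove x ys)) (equalPairs (remove x ys)) (count x ys C 2)))

  dedup-remove : ∀ x xs → dedup (remove x xs) ≡ remove x (dedup xs)
  dedup-remove x []       = refl
  dedup-remove x (y ∷ ys) with x ≟ y
  ... | yes refl = trans (dedup-remove x ys) (sym (filter-idem _ (dedup ys)))
  ... | no  _    = cong (y ∷_) (trans (cong (remove y) (dedup-remove x ys)) (filter-comm _ _ (dedup ys)))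

  -- Removing all copies of the head x, say c of them, costs 2c on the left and
  -- 3 + (c choose 2) on the right.
  private
    fuelled : ∀ f xs → length xs ≤ f → 2 * length xs ≤ 3 * length (dedup xs) + equalPairs xs
    fuelled f       []       _          = z≤n
    fuelled (suc f) (x ∷ xs) (s≤s xs≤f) = begin
      2 * suc (length xs)                                      ≡⟨ cong (λ l → 2 * suc l) (length-remove x xs) ⟩
      2 * (suc c + length R)                                   ≡⟨ *-distribˡ-+ 2 (suc c) (length R) ⟩
      2 * suc c + 2 * length R                                 ≤⟨ +-mono-≤ (2*[1+n]≤3+[1+n]C2 c)
                                                                           (fuelled f R (≤-trans (length-filter _ xs) xs≤f)) ⟩
      3 + suc c C 2 + (3 * length (dedup R) + equalPairs R)    ≡⟨ cong (λ e → 3 + e + (3 * length (dedup R) + equalPairs R))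
                                                                       ([1+n]C2≡n+nC2 c) ⟩
      3 + (c + c C 2) + (3 * length (dedup R) + equalPairs R)  ≡⟨ regroup c (c C 2) (length (dedup R)) (equalPairs R) ⟩
      3 * suc (length (dedup R)) + (c + (equalPairs R + c C 2))
        ≡⟨ cong₂ (λ d p → 3 * suc (length d) + (c + p)) (dedup-remove x xs) (sym (equalPairs-remove x xs)) ⟩
      3 * suc (length (remove x (dedup xs))) + (c + equalPairs xs) ∎
      where
      open ≤-Reasoning
      c = count x xs
      R = remove x xs
      regroup : ∀ c b d p → 3 + (c + b) + (3 * d + p) ≡ 3 * suc d + (c + (p + b))
      regroup = solve-∀

  2*length≤3*length-dedup+equalPairs : ∀ xs → 2 * length xs ≤ 3 * length (dedup xs) + equalPairs xs
  2*length≤3*length-dedup+equalPairs xs = fuelled (length xs) xs ≤-refl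

∑ : ∀ {a} {A : Set a} → List A → (A → ℕ) → ℕ
∑ []       f = 0
∑ (x ∷ xs) f = f x + ∑ xs f

syntax ∑ xs (λ x → e) = ∑[ x ∈ xs ] e

module _ {a} {A : Set a} where

  ∑-++ : ∀ xs ys (f : A → ℕ) → ∑ (xs ++ ys) f ≡ ∑ xs f + ∑ ys f
  ∑-++ []       ys f = refl
  ∑-++ (x ∷ xs) ys f = trans (cong (f x +_) (∑-++ xs ys f)) (sym (+-assoc (f x) (∑ xs f) (∑ ys f)))

  ∑-map : ∀ {b} {B : Set b} (g : B → A) xs (f : A → ℕ) → ∑ (map g xs) f ≡ ∑ xs (f ∘ g)
  ∑-map g []       f = refl
  ∑-map g (x ∷ xs) f = cong (f (g x) +_) (∑-map g xs f)

  ∑-+ : ∀ xs (f g : A → ℕ) → ∑[ x ∈ xs ] (f x + g x) ≡ ∑ xs f + ∑ xs g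
  ∑-+ []       f g = refl
  ∑-+ (x ∷ xs) f g = trans (cong (f x + g x +_) (∑-+ xs f g)) (interchange (f x) (g x) (∑ xs f) (∑ xs g))
    where
    interchange : ∀ a b c d → a + b + (c + d) ≡ a + c + (b + d)
    interchange = solve-∀

  ∑-*ˡ : ∀ c xs (f : A → ℕ) → ∑[ x ∈ xs ] (c * f x) ≡ c * ∑ xs f
  ∑-*ˡ c []       f = sym (*-zeroʳ c)
  ∑-*ˡ c (x ∷ xs) f = trans (cong (c * f x +_) (∑-*ˡ c xs f)) (sym (*-distribˡ-+ c (f x) (∑ xs f)))

  ∑-const : ∀ c (xs : List A) → ∑[ x ∈ xs ] c ≡ c * length xs
  ∑-const c []       = sym (*-zeroʳ c)
  ∑-const c (x ∷ xs) = trans (cong (c +_) (∑-const c xs)) (sym (*-suc c (length xs)))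

  ∑-mono-≤ : ∀ {xs} {f g : A → ℕ} → All (λ x → f x ≤ g x) xs → ∑ xs f ≤ ∑ xs g
  ∑-mono-≤ []           = z≤n
  ∑-mono-≤ (fx≤gx ∷ h) = +-mono-≤ fx≤gx (∑-mono-≤ h)

  ∑-indicator : ∀ {p} {P : Pred A p} (P? : Decidable P) xs → ∑[ x ∈ xs ] indicator (P? x) ≡ length (filter P? xs)
  ∑-indicator P? []       = refl
  ∑-indicator P? (x ∷ xs) with P? x
  ... | yes _ = cong suc (∑-indicator P? xs)
  ... | no  _ = ∑-indicator P? xs

module _ {s x} {S : Set s} {X : Set x} (_≟_ : DecidableEquality X) where
  open EqualPairs _≟_

  ∑count-bound : ∀ {D B} (W : List S) (y : S → X) (g : S → ℕ → X) m →
    (∀ {i} → i < m → D * ∑[ w ∈ W ] indicator (y w ≟ g w i) ≤ B) →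
    D * ∑[ w ∈ W ] count (y w) (applyUpTo (g w) m) ≤ m * B
  ∑count-bound {D}     W y g zero    _ = ≤-reflexive (trans (cong (D *_) (∑-const 0 W)) (*-zeroʳ D))
  ∑count-bound {D} {B} W y g (suc m) h = begin
    D * ∑[ w ∈ W ] (hit w + rest w)  ≡⟨ cong (D *_) (∑-+ W hit rest) ⟩
    D * (∑ W hit + ∑ W rest)         ≡⟨ *-distribˡ-+ D (∑ W hit) (∑ W rest) ⟩
    D * ∑ W hit + D * ∑ W rest       ≤⟨ +-mono-≤ (h z<s) (∑count-bound {D} {B} W y (λ w → g w ∘ suc) m (h ∘ s<s)) ⟩
    B + m * B                        ∎
    where
    open ≤-Reasoning
    hit rest : S → ℕ
    hit w  = indicator (y w ≟ g w 0)
    rest w = count (y w) (applyUpTo (g w ∘ suc) m)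

  ∑equalPairs-bound : ∀ {D B} (W : List S) (F : S → ℕ → X) L →
    (∀ {a b} → a < b → b < L → D * ∑[ w ∈ W ] indicator (F w a ≟ F w b) ≤ B) →
    D * ∑[ w ∈ W ] equalPairs (applyUpTo (F w) L) ≤ (L C 2) * B
  ∑equalPairs-bound {D}     W F zero    _ = ≤-reflexive (trans (cong (D *_) (∑-const 0 W)) (*-zeroʳ D))
  ∑equalPairs-bound {D} {B} W F (suc L) h = begin
    D * ∑[ w ∈ W ] (first w + later w)  ≡⟨ cong (D *_) (∑-+ W first later) ⟩
    D * (∑ W first + ∑ W later)         ≡⟨ *-distribˡ-+ D (∑ W first) (∑ W later) ⟩
    D * ∑ W first + D * ∑ W later       ≤⟨ +-mono-≤ (∑count-bound {D} {B} W (λ w → F w 0) (λ w → F w ∘ suc) L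
                                                       (λ i<L → h z<s (s<s i<L)))
                                                    (∑equalPairs-bound {D} {B} W (λ w → F w ∘ suc) L
                                                       (λ a<b b<L → h (s<s a<b) (s<s b<L))) ⟩
    L * B + (L C 2) * B                 ≡⟨ *-distribʳ-+ B L (L C 2) ⟨
    (L + L C 2) * B                     ≡⟨ cong (_* B) ([1+n]C2≡n+nC2 L) ⟨
    (suc L C 2) * B                     ∎
    where
    open ≤-Reasoning
    first later : S → ℕ
    first w = count (F w 0) (applyUpTo (F w ∘ suc) L)
    later w = equalPairs (applyUpTo (F w ∘ suc) L)

infix 4 _≟W_
_≟W_ : DecidableEquality Word
_≟W_ = ≡-dec _≟D_

∑-allWords-suc : ∀ n (f : Word → ℕ) →
                 ∑ (allWords (suc n)) f ≡ ∑[ v ∈ allWords n ] f (d0 ∷ v) + ∑[ v ∈ allWords n ] f (d2 ∷ v)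
∑-allWords-suc n f = trans (∑-++ (map (d0 ∷_) (allWords n)) _ f)
                           (cong₂ _+_ (∑-map (d0 ∷_) (allWords n) f) (∑-map (d2 ∷_) (allWords n) f))

length-allWords : ∀ n → length (allWords n) ≡ 2 ^ n
length-allWords zero    = refl
length-allWords (suc n) = begin
  length (map (d0 ∷_) (allWords n) ++ map (d2 ∷_) (allWords n))
    ≡⟨ length-++ (map (d0 ∷_) (allWords n)) ⟩
  length (map (d0 ∷_) (allWords n)) + length (map (d2 ∷_) (allWords n))
    ≡⟨ cong₂ _+_ (length-map (d0 ∷_) (allWords n)) (length-map (d2 ∷_) (allWords n)) ⟩
  length (allWords n) + length (allWords n)
    ≡⟨ cong₂ _+_ (length-allWords n) (length-allWords n) ⟩
  2 ^ n + 2 ^ n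
    ≡⟨ cong (2 ^ n +_) (+-identityʳ (2 ^ n)) ⟨
  2 ^ suc n ∎
  where open ≡-Reasoning

allWords-length : ∀ n → All (λ w → length w ≡ n) (allWords n)
allWords-length zero    = refl ∷ []
allWords-length (suc n) = All.++⁺ (All.map⁺ (All-map (cong suc) (allWords-length n)))
                                  (All.map⁺ (All-map (cong suc) (allWords-length n)))

agreement-step : ∀ t s (u : Word) →
  indicator (d0 ∷ s ≟W take (suc t) u) + indicator (d2 ∷ s ≟W take (suc t) u) ≤ indicator (s ≟W take t (drop 1 u))
agreement-step t s []       = z≤n
agreement-step t s (d0 ∷ r) with s ≟W take t r
... | yes _ = ≤-refl
... | no  _ = ≤-refl
agreement-step t s (d2 ∷ r) with s ≟W take t r
... | yes _ = ≤-refl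
... | no  _ = ≤-refl

-- Each letter of the window at a is forced to equal a letter of the later window at b,
-- so each letter halves the number of agreeing words.
2^t*#agreements≤2^n : ∀ n t {a b} → a < b → b + t ≤ n →
  2 ^ t * ∑[ w ∈ allWords n ] indicator (factorAt t w a ≟W factorAt t w b) ≤ 2 ^ n
2^t*#agreements≤2^n zero t {b = suc b} _ ()
2^t*#agreements≤2^n (suc n) t {suc a} {suc b} (s≤s a<b) (s≤s b+t≤n) = begin
  2 ^ t * ∑ (allWords (suc n)) agree  ≡⟨ cong (2 ^ t *_) (∑-allWords-suc n agree) ⟩
  2 ^ t * (A + A)                     ≡⟨ double (2 ^ t) A ⟩
  2 * (2 ^ t * A)                     ≤⟨ *-monoʳ-≤ 2 (2^t*#agreements≤2^n n t a<b b+t≤n) ⟩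
  2 * 2 ^ n                           ∎
  where
  open ≤-Reasoning
  agree : Word → ℕ
  agree w = indicator (factorAt t w (suc a) ≟W factorAt t w (suc b))
  A : ℕ
  A = ∑[ v ∈ allWords n ] indicator (factorAt t v a ≟W factorAt t v b)
  double : ∀ x y → x * (y + y) ≡ 2 * (x * y)
  double = solve-∀
2^t*#agreements≤2^n n zero {zero} _ _ = ≤-reflexive (begin
  ∑[ w ∈ allWords n ] 1 + 0  ≡⟨ +-identityʳ (∑[ w ∈ allWords n ] 1) ⟩
  ∑[ w ∈ allWords n ] 1      ≡⟨ ∑-const 1 (allWords n) ⟩
  1 * length (allWords n)    ≡⟨ *-identityˡ _ ⟩
  length (allWords n)        ≡⟨ length-allWords n ⟩
  2 ^ n                      ∎)
  where open ≡-Reasoning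
2^t*#agreements≤2^n (suc n) (suc t) {zero} {suc b} _ (s≤s b+1+t≤n) = begin
  2 ^ suc t * ∑ (allWords (suc n)) agree
    ≡⟨ cong (2 ^ suc t *_) (∑-allWords-suc n agree) ⟩
  2 ^ suc t * (∑[ v ∈ allWords n ] agree (d0 ∷ v) + ∑[ v ∈ allWords n ] agree (d2 ∷ v))
    ≡⟨ cong (2 ^ suc t *_) (∑-+ (allWords n) _ _) ⟨
  2 ^ suc t * ∑[ v ∈ allWords n ] (agree (d0 ∷ v) + agree (d2 ∷ v))
    ≤⟨ *-monoʳ-≤ (2 ^ suc t) (∑-mono-≤ (universal step (allWords n))) ⟩
  2 ^ suc t * ∑ (allWords n) agree′
    ≡⟨ *-assoc 2 (2 ^ t) _ ⟩
  2 * (2 ^ t * ∑ (allWords n) agree′)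
    ≤⟨ *-monoʳ-≤ 2 (2^t*#agreements≤2^n n t z<s 1+b+t≤n) ⟩
  2 * 2 ^ n ∎
  where
  open ≤-Reasoning
  agree agree′ : Word → ℕ
  agree  w = indicator (factorAt (suc t) w 0 ≟W factorAt (suc t) w (suc b))
  agree′ v = indicator (factorAt t v 0 ≟W factorAt t v (suc b))
  step : ∀ v → agree (d0 ∷ v) + agree (d2 ∷ v) ≤ agree′ v
  step v = subst (λ u → agree (d0 ∷ v) + agree (d2 ∷ v) ≤ indicator (take t v ≟W take t u))
                 (trans (drop-drop b 1 v) (cong (λ i → drop i v) (+-comm b 1)))
                 (agreement-step t (take t v) (drop b v))
  1+b+t≤n : suc b + t ≤ n
  1+b+t≤n = subst (_≤ n) (+-suc b t) b+1+t≤n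

2*⌊n/2⌋≤n : ∀ n → 2 * ⌊ n /2⌋ ≤ n
2*⌊n/2⌋≤n n = begin
  ⌊ n /2⌋ + (⌊ n /2⌋ + 0)  ≡⟨ cong (⌊ n /2⌋ +_) (+-identityʳ ⌊ n /2⌋) ⟩
  ⌊ n /2⌋ + ⌊ n /2⌋        ≤⟨ +-monoʳ-≤ ⌊ n /2⌋ (⌊n/2⌋≤⌈n/2⌉ n) ⟩
  ⌊ n /2⌋ + ⌈ n /2⌉        ≡⟨ ⌊n/2⌋+⌈n/2⌉≡n n ⟩
  n                        ∎
  where open ≤-Reasoning

2^⌊log2⌋≤n : ∀ n (rec : Acc _<_ n) → 1 ≤ n → 2 ^ ⌊log2⌋ n rec ≤ n
2^⌊log2⌋≤n (suc zero)    _        _ = ≤-refl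
2^⌊log2⌋≤n (suc (suc n)) (acc rs) _ = begin
  2 * 2 ^ ⌊log2⌋ (suc ⌊ n /2⌋) _  ≤⟨ *-monoʳ-≤ 2 (2^⌊log2⌋≤n (suc ⌊ n /2⌋) _ (s≤s z≤n)) ⟩
  2 * suc ⌊ n /2⌋                 ≡⟨ *-suc 2 ⌊ n /2⌋ ⟩
  2 + 2 * ⌊ n /2⌋                 ≤⟨ +-monoʳ-≤ 2 (2*⌊n/2⌋≤n n) ⟩
  2 + n                           ∎
  where open ≤-Reasoning

2^⌊log₂n⌋≤n : ∀ n → 1 ≤ n → 2 ^ ⌊log₂ n ⌋ ≤ n
2^⌊log₂n⌋≤n n = 2^⌊log2⌋≤n n (<-wellFounded n)

n<2^[1+⌊log₂n⌋] : ∀ n → n < 2 ^ suc ⌊log₂ n ⌋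
n<2^[1+⌊log₂n⌋] n with n <? 2 ^ suc ⌊log₂ n ⌋
... | yes n<2^[1+k] = n<2^[1+k]
... | no  n≮2^[1+k] =
  contradiction (subst (_≤ ⌊log₂ n ⌋) (⌊log₂[2^n]⌋≡n (suc ⌊log₂ n ⌋)) (⌊log₂⌋-mono-≤ (≮⇒≥ n≮2^[1+k])))
                (<⇒≱ (n<1+n ⌊log₂ n ⌋))

n<2^n : ∀ n → n < 2 ^ n
n<2^n zero    = z<s
n<2^n (suc n) = begin-strict
  suc n          ≤⟨ n<2^n n ⟩
  2 ^ n          <⟨ m<m+n (2 ^ n) (m^n>0 2 n) ⟩
  2 ^ n + 2 ^ n  ≡⟨ cong (2 ^ n +_) (+-identityʳ (2 ^ n)) ⟨
  2 ^ suc n      ∎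
  where open ≤-Reasoning

⌊log₂n⌋≤n : ∀ n → ⌊log₂ n ⌋ ≤ n
⌊log₂n⌋≤n zero    = z≤n
⌊log₂n⌋≤n (suc n) = <⇒≤ (<-≤-trans (n<2^n ⌊log₂ suc n ⌋) (2^⌊log₂n⌋≤n (suc n) (s≤s z≤n)))

13*n≤2^n : ∀ n → 7 ≤ n → 13 * n ≤ 2 ^ n
13*n≤2^n n 7≤n = go (≤⇒≤′ 7≤n)
  where
  go : ∀ {n} → 7 ≤′ n → 13 * n ≤ 2 ^ n
  go ≤′-refl            = toWitness {a? = 91 ≤? 128} tt
  go (≤′-step {n} 7≤′n) = begin
    13 * suc n       ≡⟨ *-suc 13 n ⟩
    13 + 13 * n      ≤⟨ +-monoˡ-≤ (13 * n) (≤-trans (*-monoʳ-≤ 13 (≤-trans z<s (≤′⇒≤ 7≤′n))) (go 7≤′n)) ⟩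
    2 ^ n + 13 * n   ≤⟨ +-monoʳ-≤ (2 ^ n) (≤-trans (go 7≤′n) (≤-reflexive (sym (+-identityʳ (2 ^ n))))) ⟩
    2 ^ suc n        ∎
    where open ≤-Reasoning

12*N*[K+m]+16*[1+m]C2≤29*N*[1+m] : ∀ {K m N} → N ≤ K + m → K + m < 2 * N → 13 * K ≤ N →
                                    12 * (N * (K + m)) + 16 * (suc m C 2) ≤ 29 * (N * suc m)
12*N*[K+m]+16*[1+m]C2≤29*N*[1+m] {K} {m} {N} N≤n n<2N 13K≤N = begin
  12 * (N * (K + m)) + 16 * (suc m C 2)  ≡⟨ cong (_+ 16 * (suc m C 2)) (swap N (K + m)) ⟩
  N * (12 * (K + m)) + 16 * (suc m C 2)  ≤⟨ +-mono-≤ (*-monoʳ-≤ N 12n≤13L) (*-monoʳ-≤ 16 LC2≤NL) ⟩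
  N * (13 * suc m) + 16 * (N * suc m)    ≡⟨ collect N (suc m) ⟩
  29 * (N * suc m)                       ∎
  where
  open ≤-Reasoning
  swap : ∀ N n → 12 * (N * n) ≡ N * (12 * n)
  swap = solve-∀
  collect : ∀ N L → N * (13 * L) + 16 * (N * L) ≡ 29 * (N * L)
  collect = solve-∀
  12K≤m : 12 * K ≤ m
  12K≤m = +-cancelʳ-≤ K (12 * K) m (begin
    12 * K + K  ≡⟨ +-comm (12 * K) K ⟩
    13 * K      ≤⟨ 13K≤N ⟩
    N           ≤⟨ N≤n ⟩
    K + m       ≡⟨ +-comm K m ⟩
    m + K       ∎)
  12n≤13L : 12 * (K + m) ≤ 13 * suc m
  12n≤13L = begin
    12 * (K + m)       ≡⟨ *-distribˡ-+ 12 K m ⟩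
    12 * K + 12 * m    ≤⟨ +-monoˡ-≤ (12 * m) 12K≤m ⟩
    m + 12 * m         ≤⟨ m≤n+m (m + 12 * m) 13 ⟩
    13 + (m + 12 * m)  ≡⟨ expand m ⟨
    13 * suc m         ∎
    where
    expand : ∀ m → 13 * suc m ≡ 13 + (m + 12 * m)
    expand = solve-∀
  LC2≤NL : suc m C 2 ≤ N * suc m
  LC2≤NL = *-cancelˡ-≤ 2 (begin
    2 * (suc m C 2)  ≤⟨ 2*nC2≤n*n (suc m) ⟩
    suc m * suc m    ≤⟨ *-monoʳ-≤ (suc m) (≤-trans (s≤s (m≤n+m m K)) n<2N) ⟩
    suc m * (2 * N)  ≡⟨ regroup (suc m) N ⟩
    2 * (N * suc m)  ∎)
    where
    regroup : ∀ L N → L * (2 * N) ≡ 2 * (N * L)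
    regroup = solve-∀

CountingInequality : ℕ → Set
CountingInequality n = 12 * (2 ^ k n * n) + 16 * (suc (n ∸ k n) C 2) ≤ 29 * (2 ^ k n * suc (n ∸ k n))

countingInequality? : ∀ n → Dec (CountingInequality n)
countingInequality? n = _ ≤? _

countingInequality : ∀ n → CountingInequality n
countingInequality n with n <? 128
... | yes n<128 = toWitness {a? = allUpTo? countingInequality? 128} tt n<128
... | no  n≮128 = subst (λ x → 12 * (N * x) + 16 * (suc m C 2) ≤ 29 * (N * suc m)) K+m≡n
                        (12*N*[K+m]+16*[1+m]C2≤29*N*[1+m] N≤K+m K+m<2N 13K≤N)
  where
  K m N : ℕ
  K = k n
  m = n ∸ K
  N = 2 ^ K
  K+m≡n : K + m ≡ n
  K+m≡n = m+[n∸m]≡n (⌊log₂n⌋≤n n)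
  N≤K+m : N ≤ K + m
  N≤K+m = subst (N ≤_) (sym K+m≡n) (2^⌊log₂n⌋≤n n (≤-trans (s≤s z≤n) (≮⇒≥ n≮128)))
  K+m<2N : K + m < 2 * N
  K+m<2N = subst (_< 2 * N) (sym K+m≡n) (n<2^[1+⌊log₂n⌋] n)
  13K≤N : 13 * K ≤ N
  13K≤N = 13*n≤2^n K (subst (_≤ K) (⌊log₂[2^n]⌋≡n 7) (⌊log₂⌋-mono-≤ (≮⇒≥ n≮128)))

T≤16G-from-estimates : ∀ {T G S Q N L P n} .{{_ : NonZero N}} .{{_ : NonZero L}} →
  2 * L * T ≤ 3 * S + Q → N * Q ≤ P * T → 4 * S ≤ 4 * L * G + n * T →
  12 * (N * n) + 16 * P ≤ 29 * (N * L) → T ≤ 16 * G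
T≤16G-from-estimates {T} {G} {S} {Q} {N} {L} {P} {n} lower pairs upper counting =
  *-cancelˡ-≤ (3 * (N * L)) {{m*n≢0 3 (N * L) {{_}} {{m*n≢0 N L}}}}
    (+-cancelˡ-≤ (29 * (N * L * T)) (3 * (N * L) * T) (3 * (N * L) * (16 * G)) (begin
      29 * (N * L * T) + 3 * (N * L) * T              ≡⟨ e₁ N L T ⟩
      16 * N * (2 * L * T)                            ≤⟨ *-monoʳ-≤ (16 * N) lower ⟩
      16 * N * (3 * S + Q)                            ≡⟨ e₂ N S Q ⟩
      12 * N * (4 * S) + 16 * (N * Q)                 ≤⟨ +-mono-≤ (*-monoʳ-≤ (12 * N) upper) (*-monoʳ-≤ 16 pairs) ⟩
      12 * N * (4 * L * G + n * T) + 16 * (P * T)     ≡⟨ e₃ N L G n T P ⟩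
      48 * (N * L * G) + (12 * (N * n) + 16 * P) * T  ≤⟨ +-monoʳ-≤ (48 * (N * L * G)) (*-monoˡ-≤ T counting) ⟩
      48 * (N * L * G) + 29 * (N * L) * T             ≡⟨ e₄ N L G T ⟩
      29 * (N * L * T) + 3 * (N * L) * (16 * G)       ∎))
  where
  open ≤-Reasoning
  e₁ : ∀ N L T → 29 * (N * L * T) + 3 * (N * L) * T ≡ 16 * N * (2 * L * T)
  e₁ = solve-∀
  e₂ : ∀ N S Q → 16 * N * (3 * S + Q) ≡ 12 * N * (4 * S) + 16 * (N * Q)
  e₂ = solve-∀
  e₃ : ∀ N L G n T P → 12 * N * (4 * L * G + n * T) + 16 * (P * T) ≡ 48 * (N * L * G) + (12 * (N * n) + 16 * P) * T
  e₃ = solve-∀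
  e₄ : ∀ N L G T → 48 * (N * L * G) + 29 * (N * L) * T ≡ 29 * (N * L * T) + 3 * (N * L) * (16 * G)
  e₄ = solve-∀

open EqualPairs _≟W_

offsets-≤ : ∀ {n t} → t ≤ n → offsets n t ≡ upTo (suc (n ∸ t))
offsets-≤ {n} {t} t≤n with t ≤? n
... | yes _   = refl
... | no  t≰n = contradiction t≤n t≰n

complexity-applyUpTo : ∀ t w → t ≤ length w →
  complexity t w ≡ length (dedup (applyUpTo (factorAt t w) (suc (length w ∸ t))))
complexity-applyUpTo t w t≤|w| =
  cong (length ∘ dedup) (trans (cong (map (factorAt t w)) (offsets-≤ t≤|w|)) (map-applyUpTo id (factorAt t w) _))

module Estimates (n : ℕ) where

  K L : ℕ
  K = k n
  L = suc (n ∸ K)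

  W : List Word
  W = allWords n

  factors : Word → List Word
  factors w = applyUpTo (factorAt K w) L

  complexity≡ : ∀ {w} → length w ≡ n → complexity K w ≡ length (dedup (factors w))
  complexity≡ refl = complexity-applyUpTo K _ (⌊log₂n⌋≤n n)

  complexity≤L : ∀ {w} → length w ≡ n → complexity K w ≤ L
  complexity≤L {w} |w|≡n = begin
    complexity K w              ≡⟨ complexity≡ |w|≡n ⟩
    length (dedup (factors w))  ≤⟨ length-deduplicate _≟W_ (factors w) ⟩
    length (factors w)          ≡⟨ length-applyUpTo (factorAt K w) L ⟩
    L                           ∎
    where open ≤-Reasoning

  2L≤3*complexity+equalPairs : ∀ {w} → length w ≡ n → 2 * L ≤ 3 * complexity K w + equalPairs (factors w)
  2L≤3*complexity+equalPairs {w} |w|≡n = begin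
    2 * L                                                    ≡⟨ cong (2 *_) (length-applyUpTo (factorAt K w) L) ⟨
    2 * length (factors w)                                   ≤⟨ 2*length≤3*length-dedup+equalPairs (factors w) ⟩
    3 * length (dedup (factors w)) + equalPairs (factors w)  ≡⟨ cong (λ c → 3 * c + equalPairs (factors w))
                                                                    (complexity≡ |w|≡n) ⟨
    3 * complexity K w + equalPairs (factors w)              ∎
    where open ≤-Reasoning

  4*complexity≤4L*[∈𝓕]+n : ∀ {w} → length w ≡ n → 4 * complexity K w ≤ 4 * L * indicator (inF? n w) + n
  4*complexity≤4L*[∈𝓕]+n {w} |w|≡n with inF? n w
  ... | yes _    = ≤-trans (*-monoʳ-≤ 4 (complexity≤L |w|≡n))
                           (≤-trans (≤-reflexive (sym (*-identityʳ (4 * L)))) (m≤m+n (4 * L * 1) n))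
  ... | no  n≰4C = ≤-trans (<⇒≤ (≰⇒> n≰4C)) (m≤n+m n (4 * L * 0))

  ∑complexity-lower : 2 * L * 2 ^ n ≤ 3 * ∑ W (complexity K) + ∑ W (equalPairs ∘ factors)
  ∑complexity-lower = begin
    2 * L * 2 ^ n
      ≡⟨ cong (2 * L *_) (length-allWords n) ⟨
    2 * L * length W
      ≡⟨ ∑-const (2 * L) W ⟨
    ∑[ w ∈ W ] (2 * L)
      ≤⟨ ∑-mono-≤ (All-map 2L≤3*complexity+equalPairs (allWords-length n)) ⟩
    ∑[ w ∈ W ] (3 * complexity K w + equalPairs (factors w))
      ≡⟨ ∑-+ W (λ w → 3 * complexity K w) (equalPairs ∘ factors) ⟩
    ∑[ w ∈ W ] (3 * complexity K w) + ∑ W (equalPairs ∘ factors)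
      ≡⟨ cong (_+ ∑ W (equalPairs ∘ factors)) (∑-*ˡ 3 W (complexity K)) ⟩
    3 * ∑ W (complexity K) + ∑ W (equalPairs ∘ factors) ∎
    where open ≤-Reasoning

  ∑equalPairs-upper : 2 ^ K * ∑ W (equalPairs ∘ factors) ≤ (L C 2) * 2 ^ n
  ∑equalPairs-upper = ∑equalPairs-bound _≟W_ {2 ^ K} {2 ^ n} W (factorAt K) L λ a<b b<L →
    2^t*#agreements≤2^n n K a<b (≤-trans (+-monoˡ-≤ K (s≤s⁻¹ b<L)) (≤-reflexive (m∸n+n≡m (⌊log₂n⌋≤n n))))

  ∑complexity-upper : 4 * ∑ W (complexity K) ≤ 4 * L * length (𝓕 n) + n * 2 ^ n
  ∑complexity-upper = begin
    4 * ∑ W (complexity K)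
      ≡⟨ ∑-*ˡ 4 W (complexity K) ⟨
    ∑[ w ∈ W ] (4 * complexity K w)
      ≤⟨ ∑-mono-≤ (All-map 4*complexity≤4L*[∈𝓕]+n (allWords-length n)) ⟩
    ∑[ w ∈ W ] (4 * L * indicator (inF? n w) + n)
      ≡⟨ ∑-+ W (λ w → 4 * L * indicator (inF? n w)) (λ _ → n) ⟩
    ∑[ w ∈ W ] (4 * L * indicator (inF? n w)) + ∑[ w ∈ W ] n
      ≡⟨ cong₂ _+_ (∑-*ˡ (4 * L) W (indicator ∘ inF? n)) (∑-const n W) ⟩
    4 * L * ∑[ w ∈ W ] indicator (inF? n w) + n * length W
      ≡⟨ cong₂ (λ g t → 4 * L * g + n * t) (∑-indicator (inF? n) W) (length-allWords n) ⟩
    4 * L * length (𝓕 n) + n * 2 ^ n ∎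
    where open ≤-Reasoning

lemma4p1 : (n : ℕ) → 1 ≤ n → 2 ^ n ≤ 16 * length (𝓕 n)
lemma4p1 n _ =
  T≤16G-from-estimates {S = ∑ W (complexity K)} {P = L C 2} {{m^n≢0 2 K}}
    ∑complexity-lower ∑equalPairs-upper ∑complexity-upper (countingInequality n)
  where open Estimates n
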